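{- For every $n\ge1$, let $h_n(t)$ be the $h$-polynomial of the zig-zag poset $Z_n$ and $d_n(t)$ the $n$th Delannoy polynomial. Then $h_n(t)=d_n(t)$. In particular, the number of lattice points of the preorder polytope $\mathcal{Q}_n$ of $Z_n$ is equal to the Pell number $d_n(1)$.
   Context: The zig-zag poset $Z_n$ is the partial order on $\{1,\dots,n\}$ with cover relations $i\prec i+1$ for odd $i\in\{1,\dots,n-1\}$ and $i\succ i+1$ for even $i\in\{1,\dots,n-1\}$. For a poset (or preorder) $\tau$ on $E$, the preorder polytope $\mathcal{Q}_\tau\subset\mathbb{R}^E$ is defined by $x_e\ge0$ ($e\in E$) and $\sum_{e\in\mathcal{I}}x_e\le|\mathcal{I}|$ for every order ideal $\mathcal{I}$ (subset closed downward). The $h$-polynomial of $\tau$ is $\sum_{i=0}^{|E|}h_i t^i$ where $h_i$ is the number of lattice points of $\mathcal{Q}_\tau$ with exactly $i$ nonzero coordinates. The Delannoy polynomials are defined by $d_0(t)=1$, $d_1(t)=1+t$ and $d_n(t)=(1+t)d_{n-1}(t)+t\,d_{n-2}(t)$ for $n\ge2$; the numbers $d_n(1)$ are the Pell numbers. -}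

module Defs where

open import Data.Nat using (ℕ; zero; suc; _+_; _*_; _≤_; _%_)
open import Data.Bool using (Bool; true; false)
open import Data.Fin using (Fin; toℕ)
open import Data.Fin.Subset using (Subset; _∈_; ∣_∣)
open import Data.Vec using (Vec; []; _∷_)
open import Data.List using (List; length)
open import Data.List.Relation.Unary.Unique.Propositional using (Unique)
import Data.List.Membership.Propositional as LM
open import Data.Product using (_×_)
open import Function.Bundles using (_⇔_)
open import Relation.Binary.PropositionalEquality using (_≡_)
open import Relation.Binary.Construct.Closure.ReflexiveTransitive using (Star)

-- Elements of Z_n are Fin n; the element k : Fin n stands for k+1 ∈ {1,…,n}.
-- Cover relation a ≺ b of the zig-zag poset:
--   (1-indexed) i ≺ i+1 for odd i, and i+1 ≺ i for even i.
--   (0-indexed) m ≺ m+1 for even m, and m+1 ≺ m for odd m.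
data ZCover {n : ℕ} : Fin n → Fin n → Set where
  up   : ∀ {a b} → toℕ b ≡ suc (toℕ a) → toℕ a % 2 ≡ 0 → ZCover a b
  down : ∀ {a b} → toℕ a ≡ suc (toℕ b) → toℕ b % 2 ≡ 1 → ZCover a b

_≼Z_ : {n : ℕ} → Fin n → Fin n → Set
_≼Z_ = Star ZCover

IsOrderIdeal : {n : ℕ} → Subset n → Set
IsOrderIdeal {n} I = (a b : Fin n) → b ≼Z a → a ∈ I → b ∈ I

sumOver : {n : ℕ} → Subset n → Vec ℕ n → ℕ
sumOver [] [] = 0
sumOver (true ∷ I) (x ∷ xs) = x + sumOver I xs
sumOver (false ∷ I) (x ∷ xs) = sumOver I xs

-- Lattice points of the preorder polytope Q_{Z_n} (x ∈ ℕ^n encodes x ∈ ℤ^n, x ≥ 0).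
InQZ : (n : ℕ) → Vec ℕ n → Set
InQZ n x = (I : Subset n) → IsOrderIdeal I → sumOver I x ≤ ∣ I ∣

nonzeros : {n : ℕ} → Vec ℕ n → ℕ
nonzeros [] = 0
nonzeros (zero ∷ xs) = nonzeros xs
nonzeros (suc _ ∷ xs) = suc (nonzeros xs)

HasCard : {A : Set} → (A → Set) → ℕ → Set
HasCard {A} P k = Data.Product.Σ (List A) λ L → Unique L × ((x : A) → (LM._∈_ x L ⇔ P x)) × length L ≡ k

-- Coefficients of the Delannoy polynomials: delannoyCoeff n i = [t^i] d_n(t).
-- d_0 = 1, d_1 = 1 + t, d_n = (1+t) d_{n-1} + t d_{n-2}.
delannoyCoeff : ℕ → ℕ → ℕ
delannoyCoeff zero zero = 1
delannoyCoeff zero (suc i) = 0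
delannoyCoeff (suc zero) zero = 1
delannoyCoeff (suc zero) (suc zero) = 1
delannoyCoeff (suc zero) (suc (suc i)) = 0
delannoyCoeff (suc (suc n)) zero = delannoyCoeff (suc n) zero
delannoyCoeff (suc (suc n)) (suc i) =
  delannoyCoeff (suc n) (suc i) + delannoyCoeff (suc n) i + delannoyCoeff n i

delannoyEval : ℕ → ℕ → ℕ
delannoyEval zero t = 1
delannoyEval (suc zero) t = 1 + t
delannoyEval (suc (suc n)) t = (1 + t) * delannoyEval (suc n) t + t * delannoyEval n t

module Submission where

-- Every order ideal of Z_n is a disjoint union of intervals [l, r] starting at a valley (a minimal
-- element) and ending at a valley or at n, so x lies in Q_n iff each such interval carries at most
-- r − l + 1.  Reading x from the left it suffices to remember, before a peak, the least slack σ of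
-- these constraints over intervals ending just before it, and before a valley the deficit δ by
-- which the preceding peak overshoots; for lattice points both stay in {0, 1}.  Thus Q_n ∩ ℕⁿ is
-- the language of a four-state automaton.  Grading the words accepted from each state by their
-- number of nonzero letters gives d_n (states σ = 0 and δ = 0), d_{n−1} (δ = 1) and
-- d_n + t·d_{n−1} (σ = 1), all by the recurrence d_{n+1} = (1 + t)·d_n + t·d_{n−1}.

open import Defs
open import Data.Nat using (ℕ; zero; suc; _+_; _*_; _∸_; _≤_; _<_; z≤n; s≤s; s≤s⁻¹)
open import Data.Nat.Properties
  using ( _≟_; _≤?_; suc-injective; +-assoc; +-comm; +-suc; +-identityʳ; +-monoˡ-≤; +-monoʳ-≤
        ; ≤-refl; ≤-trans; ≰⇒≥; n≤0⇒n≡0; m≤m+n; m+n≤o⇒m≤o; m+n≤o⇒n≤o; m+n≤o⇒m≤o∸n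
        ; m≤n+o⇒m∸n≤o; m≤n+m∸n; m+[n∸m]≡n; m≤n⇒m∸n≡0; +-∸-comm; module ≤-Reasoning )
open import Data.Nat.ListAction using (sum)
open import Data.Nat.ListAction.Properties using (sum-++)
open import Data.Nat.Tactic.RingSolver using (solve-∀)
open import Data.Bool using (true; false; if_then_else_)
open import Data.Fin using (Fin; zero; suc)
open import Data.Fin.Subset using (Subset; ∣_∣; ⊥) renaming (_∈_ to _∈ₛ_)
open import Data.Fin.Subset.Properties using (drop-there; ∣⊥∣≡0)
open import Data.Vec using (Vec; []; _∷_; here; there)
open import Data.Vec.Properties using ([]=⇒lookup; ∷-injectiveˡ; ∷-injectiveʳ)
open import Data.List using (List; []; _∷_; _++_; map; concatMap; upTo; length; filter)
open import Data.List.Properties using (map-++; map-∘; map-cong)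
open import Data.List.Membership.Propositional using (_∈_; find; lose)
open import Data.List.Membership.Propositional.Properties
  using (∈-map⁺; ∈-map⁻; ∈-concatMap⁺; ∈-concatMap⁻; ∈-upTo⁺; ∈-upTo⁻; ∈-filter⁺; ∈-filter⁻)
open import Data.List.Relation.Unary.Any using (here)
open import Data.List.Relation.Unary.All using ([]; universal)
open import Data.List.Relation.Unary.All.Properties using () renaming (map⁺ to All-map⁺)
open import Data.List.Relation.Unary.AllPairs using ([]; _∷_) renaming (map to AllPairs-map)
open import Data.List.Relation.Unary.AllPairs.Properties using () renaming (map⁺ to AllPairs-map⁺)
open import Data.List.Relation.Unary.Unique.Propositional using (Unique)
import Data.List.Relation.Unary.Unique.Propositional.Properties as Unique
open import Data.List.Relation.Binary.Disjoint.Propositional using (Disjoint)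
open import Data.Unit using (⊤; tt)
open import Data.Product using (_×_; _,_; proj₁; proj₂)
open import Function using (_∘_)
open import Function.Bundles using (_⇔_; mk⇔; Equivalence)
open import Relation.Nullary using (yes; no; does)
open import Relation.Unary using (Decidable)
open import Relation.Binary.PropositionalEquality
  using (_≡_; _≢_; refl; sym; trans; subst; cong; cong₂; module ≡-Reasoning)
open import Relation.Binary.Construct.Closure.ReflexiveTransitive using (ε; _◅_; gmap)

-- Order ideals of Z_n

headOr : ∀ {A : Set} {n} → A → Vec A n → A
headOr d []      = d
headOr _ (x ∷ _) = x

-- Ideals of a zig-zag starting at a valley, resp. a peak.  The default of headOr makes the missing
-- neighbour at the right end harmless.
ValleyIdeal PeakIdeal : ∀ {n} → Subset n → Set
ValleyIdeal []      = ⊤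
ValleyIdeal (α ∷ J) = (headOr false J ≡ true → α ≡ true) × PeakIdeal J
PeakIdeal []      = ⊤
PeakIdeal (β ∷ J) = (β ≡ true → headOr true J ≡ true) × ValleyIdeal J

ValleyIdeal-⊥ : ∀ n → ValleyIdeal (⊥ {n})
PeakIdeal-⊥   : ∀ n → PeakIdeal (⊥ {n})
ValleyIdeal-⊥ zero          = tt
ValleyIdeal-⊥ (suc zero)    = (λ ()) , tt
ValleyIdeal-⊥ (suc (suc n)) = (λ ()) , PeakIdeal-⊥ (suc n)
PeakIdeal-⊥ zero    = tt
PeakIdeal-⊥ (suc n) = (λ ()) , ValleyIdeal-⊥ n

ZCover-shift₂ : ∀ {n} {a b : Fin n} → ZCover a b → ZCover {suc (suc n)} (suc (suc a)) (suc (suc b))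
ZCover-shift₂ (up b≡1+a a-even)  = up (cong (2 +_) b≡1+a) a-even
ZCover-shift₂ (down a≡1+b b-odd) = down (cong (2 +_) a≡1+b) b-odd

ZCover-unshift₂ : ∀ {n} {a b : Fin n} → ZCover {suc (suc n)} (suc (suc a)) (suc (suc b)) → ZCover a b
ZCover-unshift₂ (up b≡1+a a-even)  = up (suc-injective (suc-injective b≡1+a)) a-even
ZCover-unshift₂ (down a≡1+b b-odd) = down (suc-injective (suc-injective a≡1+b)) b-odd

IsOrderIdeal-drop₂ : ∀ {n α β} {J : Subset n} → IsOrderIdeal (α ∷ β ∷ J) → IsOrderIdeal J
IsOrderIdeal-drop₂ ideal a b b≼a a∈J = drop-there (drop-there
  (ideal (suc (suc a)) (suc (suc b)) (gmap _ ZCover-shift₂ b≼a) (there (there a∈J))))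

IsOrderIdeal⇒ValleyIdeal : ∀ {n} (I : Subset n) → IsOrderIdeal I → ValleyIdeal I
IsOrderIdeal⇒ValleyIdeal []          _     = tt
IsOrderIdeal⇒ValleyIdeal (α ∷ [])    _     = (λ ()) , tt
IsOrderIdeal⇒ValleyIdeal (α ∷ β ∷ J) ideal =
  β⇒α , β⇒next J ideal , IsOrderIdeal⇒ValleyIdeal J (IsOrderIdeal-drop₂ ideal)
  where
  β⇒α : β ≡ true → α ≡ true
  β⇒α refl = []=⇒lookup (ideal (suc zero) zero (up refl refl ◅ ε) (there here))
  β⇒next : ∀ {n} (J : Subset n) → IsOrderIdeal (α ∷ β ∷ J) → β ≡ true → headOr true J ≡ true
  β⇒next []      _     _    = refl
  β⇒next (γ ∷ J) ideal refl = []=⇒lookup (drop-there (drop-there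
    (ideal (suc zero) (suc (suc zero)) (down refl refl ◅ ε) (there here))))

ValleyIdeal-closed : ∀ {n} (I : Subset n) → ValleyIdeal I → ∀ {b c} → ZCover b c → c ∈ₛ I → b ∈ₛ I
ValleyIdeal-closed (α ∷ β ∷ J) (β⇒α , _) {zero} {suc zero} (up _ _) (there here) with β⇒α refl
... | refl = here
ValleyIdeal-closed (α ∷ β ∷ γ ∷ J) (_ , β⇒γ , _) {suc (suc zero)} {suc zero} (down _ _) (there here)
  with β⇒γ refl
... | refl = there (there here)
ValleyIdeal-closed (α ∷ β ∷ J) (_ , _ , J-ideal) {suc (suc b)} {suc (suc c)} b⋖c (there (there c∈J)) =
  there (there (ValleyIdeal-closed J J-ideal (ZCover-unshift₂ b⋖c) c∈J))
ValleyIdeal-closed _ _ {zero}          {zero}          (up () _)   _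
ValleyIdeal-closed _ _ {zero}          {suc (suc _)}   (up () _)   _
ValleyIdeal-closed _ _ {suc zero}                      (up _ ())   _
ValleyIdeal-closed _ _ {suc (suc _)}   {zero}          (up () _)   _
ValleyIdeal-closed _ _ {suc (suc _)}   {suc zero}      (up () _)   _
ValleyIdeal-closed _ _ {c = zero}                    (down _ ()) _
ValleyIdeal-closed _ _ {zero}          {suc _}         (down () _) _
ValleyIdeal-closed _ _ {suc zero}      {suc _}         (down () _) _
ValleyIdeal-closed _ _ {suc (suc (suc _))} {suc zero}  (down () _) _

ValleyIdeal⇒IsOrderIdeal : ∀ {n} (I : Subset n) → ValleyIdeal I → IsOrderIdeal I
ValleyIdeal⇒IsOrderIdeal I valley a .a ε           a∈I = a∈I
ValleyIdeal⇒IsOrderIdeal I valley a b  (b⋖c ◅ c≼a) a∈I =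
  ValleyIdeal-closed I valley b⋖c (ValleyIdeal⇒IsOrderIdeal I valley a _ c≼a a∈I)

-- Slack and deficit

x≤[n∸m]+k⇒m+x≤n+k : ∀ {m n x} k → m ≤ n → x ≤ (n ∸ m) + k → m + x ≤ n + k
x≤[n∸m]+k⇒m+x≤n+k {m} {n} {x} k m≤n x≤ = begin
  m + x            ≤⟨ +-monoʳ-≤ m x≤ ⟩
  m + (n ∸ m + k)  ≡⟨ +-assoc m (n ∸ m) k ⟨
  m + (n ∸ m) + k  ≡⟨ cong (_+ k) (m+[n∸m]≡n m≤n) ⟩
  n + k            ∎
  where open ≤-Reasoning

m+x≤n+k⇒x≤[n∸m]+k : ∀ {m n x} k → m ≤ n → m + x ≤ n + k → x ≤ (n ∸ m) + k
m+x≤n+k⇒x≤[n∸m]+k {m} {n} {x} k m≤n m+x≤ = begin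
  x          ≤⟨ m+n≤o⇒m≤o∸n x (subst (_≤ n + k) (+-comm m x) m+x≤) ⟩
  n + k ∸ m  ≡⟨ +-∸-comm k m≤n ⟩
  n ∸ m + k  ∎
  where open ≤-Reasoning

[m∸n]+x≤k⇒m+x≤n+k : ∀ {m n x k} → (m ∸ n) + x ≤ k → m + x ≤ n + k
[m∸n]+x≤k⇒m+x≤n+k {m} {n} {x} {k} h = begin
  m + x            ≤⟨ +-monoˡ-≤ x (m≤n+m∸n m n) ⟩
  n + (m ∸ n) + x  ≡⟨ +-assoc n (m ∸ n) x ⟩
  n + (m ∸ n + x)  ≤⟨ +-monoʳ-≤ n h ⟩
  n + k            ∎
  where open ≤-Reasoning

m+x≤n+k⇒[m∸n]+x≤k : ∀ {m n x k} → x ≤ k → m + x ≤ n + k → (m ∸ n) + x ≤ k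
m+x≤n+k⇒[m∸n]+x≤k {m} {n} {x} {k} x≤k m+x≤ with m ≤? n
... | yes m≤n = subst (λ d → d + x ≤ k) (sym (m≤n⇒m∸n≡0 m≤n)) x≤k
... | no  m≰n = subst (_≤ k) (+-∸-comm x (≰⇒≥ m≰n)) (m≤n+o⇒m∸n≤o (m + x) n m+x≤)

if-then-0≤ : ∀ h k → (if h then k else 0) ≤ k
if-then-0≤ true  k = ≤-refl
if-then-0≤ false k = z≤n

if-false : ∀ {h} k → (h ≡ true → false ≡ true) → (if h then k else 0) ≡ 0
if-false {true}  k h⇒false with h⇒false refl
... | ()
if-false {false} k _ = refl

-- x is the part of a zig-zag to the right of some prefix.  An ideal J containing the first entry of
-- x merges with intervals of the prefix, which leave a deficit δ before a valley and a slack σ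
-- before a peak.  For J = [] the default of headOr charges δ too: a deficit must be paid off before
-- the right end.
ValleyFeasible PeakFeasible : ∀ {n} → ℕ → Vec ℕ n → Set
ValleyFeasible {n} δ x =
  (J : Subset n) → ValleyIdeal J → (if headOr true J then δ else 0) + sumOver J x ≤ ∣ J ∣
PeakFeasible {n} σ x =
  (J : Subset n) → PeakIdeal J → sumOver J x ≤ (if headOr false J then σ else 0) + ∣ J ∣

InQZ⇔ValleyFeasible : ∀ n (x : Vec ℕ n) → InQZ n x ⇔ ValleyFeasible 0 x
InQZ⇔ValleyFeasible n x = mk⇔
  (λ inQ J J-ideal → ≤-trans (+-monoˡ-≤ (sumOver J x) (if-then-0≤ (headOr true J) 0))
                              (inQ J (ValleyIdeal⇒IsOrderIdeal J J-ideal)))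
  (λ feasible I I-ideal → m+n≤o⇒n≤o _ (feasible I (IsOrderIdeal⇒ValleyIdeal I I-ideal)))

ValleyFeasible-[] : ∀ {δ} → ValleyFeasible δ [] → δ ≡ 0
ValleyFeasible-[] {δ} feasible = n≤0⇒n≡0 (m+n≤o⇒m≤o δ (feasible [] tt))

ValleyFeasible-∷ : ∀ {n δ a} {r : Vec ℕ n} →
                   δ + a ≤ 1 → PeakFeasible (1 ∸ (δ + a)) r → ValleyFeasible δ (a ∷ r)
ValleyFeasible-∷ {δ = δ} {a} {r} δ+a≤1 feasible (true ∷ J) (_ , J-ideal) =
  subst (_≤ suc ∣ J ∣) (+-assoc δ a (sumOver J r))
    (x≤[n∸m]+k⇒m+x≤n+k ∣ J ∣ δ+a≤1
      (≤-trans (feasible J J-ideal) (+-monoˡ-≤ ∣ J ∣ (if-then-0≤ (headOr false J) _))))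
ValleyFeasible-∷ {r = r} _ feasible (false ∷ J) (J⇒false , J-ideal) =
  subst (λ s → sumOver J r ≤ s + ∣ J ∣) (if-false _ J⇒false) (feasible J J-ideal)

ValleyFeasible-∷⁻ : ∀ {n δ a} {r : Vec ℕ n} →
                    ValleyFeasible δ (a ∷ r) → δ + a ≤ 1 × PeakFeasible (1 ∸ (δ + a)) r
ValleyFeasible-∷⁻ {n} {δ} {a} {r} feasible = δ+a≤1 , tail-feasible
  where
  δ+a≤1 : δ + a ≤ 1
  δ+a≤1 = begin
    δ + a                  ≤⟨ +-monoʳ-≤ δ (m≤m+n a _) ⟩
    δ + (a + sumOver ⊥ r)  ≤⟨ feasible (true ∷ ⊥) ((λ _ → refl) , PeakIdeal-⊥ n) ⟩
    suc ∣ ⊥ {n} ∣          ≡⟨ cong suc (∣⊥∣≡0 n) ⟩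
    1                      ∎
    where open ≤-Reasoning
  tail-feasible : PeakFeasible (1 ∸ (δ + a)) r
  tail-feasible (true ∷ J) J-ideal =
    m+x≤n+k⇒x≤[n∸m]+k (suc ∣ J ∣) δ+a≤1
      (subst (_≤ 1 + suc ∣ J ∣) (sym (+-assoc δ a _))
        (feasible (true ∷ true ∷ J) ((λ _ → refl) , J-ideal)))
  tail-feasible []          J-ideal = feasible (false ∷ []) ((λ ()) , J-ideal)
  tail-feasible (false ∷ J) J-ideal = feasible (false ∷ false ∷ J) ((λ ()) , J-ideal)

PeakFeasible-∷ : ∀ {n σ b} {r : Vec ℕ n} → ValleyFeasible (b ∸ suc σ) r → PeakFeasible σ (b ∷ r)
PeakFeasible-∷ {σ = σ} {b} {r} feasible (true ∷ J) (reaches , J-ideal) =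
  subst (b + sumOver J r ≤_) (sym (+-suc σ ∣ J ∣)) ([m∸n]+x≤k⇒m+x≤n+k {b}
    (subst (λ h → (if h then b ∸ suc σ else 0) + sumOver J r ≤ ∣ J ∣) (reaches refl)
      (feasible J J-ideal)))
PeakFeasible-∷ feasible (false ∷ J) (_ , J-ideal) = m+n≤o⇒n≤o _ (feasible J J-ideal)

PeakFeasible-∷⁻ : ∀ {n σ b} {r : Vec ℕ n} → PeakFeasible σ (b ∷ r) → ValleyFeasible (b ∸ suc σ) r
PeakFeasible-∷⁻ {σ = σ} {b} {r} feasible = tail-feasible
  where
  uncharged : ∀ J → ValleyIdeal J → sumOver J r ≤ ∣ J ∣
  uncharged J J-ideal = feasible (false ∷ J) ((λ ()) , J-ideal)
  charged : ∀ J → headOr true J ≡ true → ValleyIdeal J → (b ∸ suc σ) + sumOver J r ≤ ∣ J ∣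
  charged J reaches J-ideal = m+x≤n+k⇒[m∸n]+x≤k (uncharged J J-ideal)
    (subst (b + sumOver J r ≤_) (+-suc σ ∣ J ∣) (feasible (true ∷ J) ((λ _ → reaches) , J-ideal)))
  tail-feasible : ValleyFeasible (b ∸ suc σ) r
  tail-feasible []          = charged [] refl
  tail-feasible (true ∷ J)  = charged (true ∷ J) refl
  tail-feasible (false ∷ J) = uncharged (false ∷ J)

ValleyFeasible-deficit≤1 : ∀ {n δ} {r : Vec ℕ n} → ValleyFeasible δ r → δ ≤ 1
ValleyFeasible-deficit≤1 {r = []} feasible = subst (_≤ 1) (sym (ValleyFeasible-[] feasible)) z≤n
ValleyFeasible-deficit≤1 {δ = δ} {r = _ ∷ _} feasible =
  m+n≤o⇒m≤o δ (proj₁ (ValleyFeasible-∷⁻ feasible))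

-- The automaton

choices : ∀ {n} → ℕ → (ℕ → List (Vec ℕ n)) → List (Vec ℕ (suc n))
choices k f = concatMap (λ x → map (x ∷_) (f x)) (upTo k)

module _ {n} (k : ℕ) (f : ℕ → List (Vec ℕ n)) where

  ∈-choices⁺ : ∀ {x v} → x < k → v ∈ f x → x ∷ v ∈ choices k f
  ∈-choices⁺ {x} x<k v∈fx = ∈-concatMap⁺ _ (lose (∈-upTo⁺ x<k) (∈-map⁺ (x ∷_) v∈fx))

  ∈-choices⁻ : ∀ {x v} → x ∷ v ∈ choices k f → x < k × v ∈ f x
  ∈-choices⁻ x∷v∈ with find (∈-concatMap⁻ _ {xs = upTo k} x∷v∈)
  ... | y , y∈upTo , x∷v∈map with ∈-map⁻ (y ∷_) x∷v∈map
  ...   | u , u∈fy , refl = ∈-upTo⁻ y∈upTo , u∈fy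

  choices-unique : (∀ x → Unique (f x)) → Unique (choices k f)
  choices-unique f-unique =
    Unique.concat⁺ (All-map⁺ (universal (λ x → Unique.map⁺ ∷-injectiveʳ (f-unique x)) (upTo k)))
                   (AllPairs-map⁺ (AllPairs-map disjoint (Unique.upTo⁺ k)))
    where
    disjoint : ∀ {x y} → x ≢ y → Disjoint (map (x ∷_) (f x)) (map (y ∷_) (f y))
    disjoint x≢y (v∈x∷ , v∈y∷) with ∈-map⁻ _ v∈x∷ | ∈-map⁻ _ v∈y∷
    ... | _ , _ , refl | _ , _ , x∷u≡y∷w = x≢y (∷-injectiveˡ x∷u≡y∷w)

-- Truncation in b ∸ suc σ is intended: a peak within its slack leaves no deficit.
valleyPoints peakPoints : ℕ → (n : ℕ) → List (Vec ℕ n)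
valleyPoints δ (suc n)    = choices (2 ∸ δ) (λ a → peakPoints (1 ∸ (δ + a)) n)
valleyPoints zero zero    = [] ∷ []
valleyPoints (suc _) zero = []
peakPoints σ zero    = [] ∷ []
peakPoints σ (suc n) = choices (3 + σ) (λ b → valleyPoints (b ∸ suc σ) n)

n<o∸m⇒m+n<o : ∀ m o {n} → n < o ∸ m → m + n < o
n<o∸m⇒m+n<o zero    o       n<o   = n<o
n<o∸m⇒m+n<o (suc m) (suc o) n<o∸m = s≤s (n<o∸m⇒m+n<o m o n<o∸m)

m+n<o⇒n<o∸m : ∀ m o {n} → m + n < o → n < o ∸ m
m+n<o⇒n<o∸m zero    o       m+n<o = m+n<o
m+n<o⇒n<o∸m (suc m) (suc o) m+n<o = m+n<o⇒n<o∸m m o (s≤s⁻¹ m+n<o)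

m∸n≤1⇒m<2+n : ∀ m n → m ∸ n ≤ 1 → m < 2 + n
m∸n≤1⇒m<2+n m n m∸n≤1 = s≤s (begin
  m            ≤⟨ m≤n+m∸n m n ⟩
  n + (m ∸ n)  ≤⟨ +-monoʳ-≤ n m∸n≤1 ⟩
  n + 1        ≡⟨ +-comm n 1 ⟩
  1 + n        ∎)
  where open ≤-Reasoning

valleyPoints-sound : ∀ δ n {x : Vec ℕ n} → x ∈ valleyPoints δ n → ValleyFeasible δ x
peakPoints-sound   : ∀ σ n {x : Vec ℕ n} → x ∈ peakPoints σ n → PeakFeasible σ x
valleyPoints-sound δ (suc n) {a ∷ r} a∷r∈
  with ∈-choices⁻ (2 ∸ δ) (λ a → peakPoints (1 ∸ (δ + a)) n) a∷r∈
... | a<2∸δ , r∈ = ValleyFeasible-∷ (s≤s⁻¹ (n<o∸m⇒m+n<o δ 2 a<2∸δ)) (peakPoints-sound _ n r∈)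
valleyPoints-sound zero zero (here refl) [] _ = z≤n
peakPoints-sound σ zero    (here refl) [] _ = z≤n
peakPoints-sound σ (suc n) {b ∷ r} b∷r∈ = PeakFeasible-∷ (valleyPoints-sound _ n
  (proj₂ (∈-choices⁻ (3 + σ) (λ b → valleyPoints (b ∸ suc σ) n) b∷r∈)))

valleyPoints-complete : ∀ δ n {x : Vec ℕ n} → ValleyFeasible δ x → x ∈ valleyPoints δ n
peakPoints-complete   : ∀ σ n {x : Vec ℕ n} → PeakFeasible σ x → x ∈ peakPoints σ n
valleyPoints-complete δ (suc n) {a ∷ r} feasible with ValleyFeasible-∷⁻ feasible
... | δ+a≤1 , r-feasible = ∈-choices⁺ (2 ∸ δ) (λ a → peakPoints (1 ∸ (δ + a)) n)
  (m+n<o⇒n<o∸m δ 2 (s≤s δ+a≤1)) (peakPoints-complete _ n r-feasible)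
valleyPoints-complete δ zero {[]} feasible with ValleyFeasible-[] feasible
... | refl = here refl
peakPoints-complete σ zero    {[]} _ = here refl
peakPoints-complete σ (suc n) {b ∷ r} feasible = ∈-choices⁺ (3 + σ) (λ b → valleyPoints (b ∸ suc σ) n)
  (m∸n≤1⇒m<2+n b (suc σ) (ValleyFeasible-deficit≤1 r-feasible)) (valleyPoints-complete _ n r-feasible)
  where r-feasible = PeakFeasible-∷⁻ feasible

valleyPoints-unique : ∀ δ n → Unique (valleyPoints δ n)
peakPoints-unique   : ∀ σ n → Unique (peakPoints σ n)
valleyPoints-unique δ (suc n)    = choices-unique (2 ∸ δ) _ (λ _ → peakPoints-unique _ n)
valleyPoints-unique zero zero    = [] ∷ []
valleyPoints-unique (suc _) zero = []
peakPoints-unique σ zero    = [] ∷ []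
peakPoints-unique σ (suc n) = choices-unique (3 + σ) _ (λ _ → valleyPoints-unique _ n)

∈valleyPoints⇔InQZ : ∀ n (x : Vec ℕ n) → x ∈ valleyPoints 0 n ⇔ InQZ n x
∈valleyPoints⇔InQZ n x = mk⇔
  (λ x∈ → Equivalence.from (InQZ⇔ValleyFeasible n x) (valleyPoints-sound 0 n x∈))
  (λ inQ → valleyPoints-complete 0 n (Equivalence.to (InQZ⇔ValleyFeasible n x) inQ))

-- Counting accepted words

-- The pairing of the h-polynomial Σ_{v ∈ L} t^(nonzeros v) with w.
weigh : ∀ {n} → (ℕ → ℕ) → List (Vec ℕ n) → ℕ
weigh w L = sum (map (w ∘ nonzeros) L)

weigh-++ : ∀ {n} w (L M : List (Vec ℕ n)) → weigh w (L ++ M) ≡ weigh w L + weigh w M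
weigh-++ w L M = trans (cong sum (map-++ _ L M)) (sum-++ (map _ L) _)

weigh-concatMap : ∀ {A : Set} {n} w (g : A → List (Vec ℕ n)) xs →
                  weigh w (concatMap g xs) ≡ sum (map (weigh w ∘ g) xs)
weigh-concatMap w g []       = refl
weigh-concatMap w g (x ∷ xs) =
  trans (weigh-++ w (g x) _) (cong (weigh w (g x) +_) (weigh-concatMap w g xs))

weigh-prepend : ∀ {n} w x (L : List (Vec ℕ n)) →
                weigh w (map (x ∷_) L) ≡ weigh (λ m → w (nonzeros (x ∷ []) + m)) L
weigh-prepend w zero    L = cong sum (sym (map-∘ L))
weigh-prepend w (suc _) L = cong sum (sym (map-∘ L))

weigh-choices : ∀ {n} w k (f : ℕ → List (Vec ℕ n)) →
  weigh w (choices k f) ≡ sum (map (λ x → weigh (λ m → w (nonzeros (x ∷ []) + m)) (f x)) (upTo k))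
weigh-choices w k f =
  trans (weigh-concatMap w _ (upTo k)) (cong sum (map-cong (λ x → weigh-prepend w x (f x)) (upTo k)))

indicator : ℕ → ℕ → ℕ
indicator i m = if does (m ≟ i) then 1 else 0

weigh-indicator : ∀ {n} i (L : List (Vec ℕ n)) →
                  weigh (indicator i) L ≡ length (filter (λ v → nonzeros v ≟ i) L)
weigh-indicator i []      = refl
weigh-indicator i (v ∷ L) with does (nonzeros v ≟ i)
... | true  = cong suc (weigh-indicator i L)
... | false = weigh-indicator i L

weigh-one : ∀ {n} (L : List (Vec ℕ n)) → weigh (λ _ → 1) L ≡ length L
weigh-one []      = refl
weigh-one (_ ∷ L) = cong suc (weigh-one L)

-- delannoyPairing n w = Σᵢ [tⁱ] dₙ(t) · w i, and delannoyPairing₋₁ pairs with d_{n−1}, d_{−1} = 0.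
delannoyPairing : ℕ → (ℕ → ℕ) → ℕ
delannoyPairing zero          w = w 0
delannoyPairing (suc zero)    w = w 0 + w 1
delannoyPairing (suc (suc n)) w =
  delannoyPairing (suc n) w + delannoyPairing (suc n) (w ∘ suc) + delannoyPairing n (w ∘ suc)

delannoyPairing₋₁ : ℕ → (ℕ → ℕ) → ℕ
delannoyPairing₋₁ zero    _ = 0
delannoyPairing₋₁ (suc n) w = delannoyPairing n w

delannoyPairing-suc : ∀ n w → delannoyPairing (suc n) w ≡
  delannoyPairing n w + delannoyPairing n (w ∘ suc) + delannoyPairing₋₁ n (w ∘ suc)
delannoyPairing-suc zero    w = sym (+-identityʳ _)
delannoyPairing-suc (suc n) w = refl

delannoyPairing-0 : ∀ n → delannoyPairing n (λ _ → 0) ≡ 0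
delannoyPairing-0 zero          = refl
delannoyPairing-0 (suc zero)    = refl
delannoyPairing-0 (suc (suc n)) =
  cong₂ _+_ (cong₂ _+_ (delannoyPairing-0 (suc n)) (delannoyPairing-0 (suc n))) (delannoyPairing-0 n)

delannoyPairing-indicator : ∀ n i → delannoyPairing n (indicator i) ≡ delannoyCoeff n i
delannoyPairing-indicator zero          zero          = refl
delannoyPairing-indicator zero          (suc i)       = refl
delannoyPairing-indicator (suc zero)    zero          = refl
delannoyPairing-indicator (suc zero)    (suc zero)    = refl
delannoyPairing-indicator (suc zero)    (suc (suc i)) = refl
delannoyPairing-indicator (suc (suc n)) zero          = begin
  delannoyPairing (suc n) (indicator 0) + delannoyPairing (suc n) (λ _ → 0) + delannoyPairing n (λ _ → 0)
    ≡⟨ cong₂ _+_ (cong₂ _+_ (delannoyPairing-indicator (suc n) 0) (delannoyPairing-0 (suc n)))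
                 (delannoyPairing-0 n) ⟩
  delannoyCoeff (suc n) 0 + 0 + 0
    ≡⟨ trans (+-identityʳ _) (+-identityʳ _) ⟩
  delannoyCoeff (suc n) 0 ∎
  where open ≡-Reasoning
delannoyPairing-indicator (suc (suc n)) (suc i) =
  cong₂ _+_ (cong₂ _+_ (delannoyPairing-indicator (suc n) (suc i)) (delannoyPairing-indicator (suc n) i))
            (delannoyPairing-indicator n i)

delannoyPairing-1 : ∀ n → delannoyPairing n (λ _ → 1) ≡ delannoyEval n 1
delannoyPairing-1 zero          = refl
delannoyPairing-1 (suc zero)    = refl
delannoyPairing-1 (suc (suc n)) = begin
  delannoyPairing (suc n) (λ _ → 1) + delannoyPairing (suc n) (λ _ → 1) + delannoyPairing n (λ _ → 1)
    ≡⟨ cong₂ _+_ (cong₂ _+_ (delannoyPairing-1 (suc n)) (delannoyPairing-1 (suc n)))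
                 (delannoyPairing-1 n) ⟩
  delannoyEval (suc n) 1 + delannoyEval (suc n) 1 + delannoyEval n 1
    ≡⟨ double (delannoyEval (suc n) 1) (delannoyEval n 1) ⟩
  2 * delannoyEval (suc n) 1 + 1 * delannoyEval n 1 ∎
  where
  open ≡-Reasoning
  double : ∀ x y → x + x + y ≡ 2 * x + 1 * y
  double = solve-∀

weigh-valleyPoints₀ : ∀ n w → weigh w (valleyPoints 0 n) ≡ delannoyPairing n w
weigh-valleyPoints₁ : ∀ n w → weigh w (valleyPoints 1 n) ≡ delannoyPairing₋₁ n w
weigh-peakPoints₀   : ∀ n w → weigh w (peakPoints 0 n) ≡ delannoyPairing n w
weigh-peakPoints₁   : ∀ n w → weigh w (peakPoints 1 n) ≡
                      delannoyPairing n w + delannoyPairing₋₁ n (w ∘ suc)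

weigh-valleyPoints₀ zero    w = +-identityʳ (w 0)
weigh-valleyPoints₀ (suc n) w = begin
  weigh w (valleyPoints 0 (suc n))
    ≡⟨ weigh-choices w 2 (λ a → peakPoints (1 ∸ a) n) ⟩
  weigh w (peakPoints 1 n) + (weigh (w ∘ suc) (peakPoints 0 n) + 0)
    ≡⟨ cong₂ _+_ (weigh-peakPoints₁ n w) (cong (_+ 0) (weigh-peakPoints₀ n (w ∘ suc))) ⟩
  Δ n w + Δ₋₁ n (w ∘ suc) + (Δ n (w ∘ suc) + 0)
    ≡⟨ rearrange (Δ n w) (Δ n (w ∘ suc)) (Δ₋₁ n (w ∘ suc)) ⟩
  Δ n w + Δ n (w ∘ suc) + Δ₋₁ n (w ∘ suc)
    ≡⟨ delannoyPairing-suc n w ⟨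
  Δ (suc n) w ∎
  where
  open ≡-Reasoning
  Δ = delannoyPairing
  Δ₋₁ = delannoyPairing₋₁
  rearrange : ∀ a b c → a + c + (b + 0) ≡ a + b + c
  rearrange = solve-∀
weigh-valleyPoints₁ zero    w = refl
weigh-valleyPoints₁ (suc n) w =
  trans (weigh-choices w 1 (λ a → peakPoints (1 ∸ suc a) n))
        (trans (+-identityʳ _) (weigh-peakPoints₀ n w))
weigh-peakPoints₀ zero    w = +-identityʳ (w 0)
weigh-peakPoints₀ (suc n) w = begin
  weigh w (peakPoints 0 (suc n))
    ≡⟨ weigh-choices w 3 (λ b → valleyPoints (b ∸ 1) n) ⟩
  weigh w (valleyPoints 0 n) +
    (weigh (w ∘ suc) (valleyPoints 0 n) + (weigh (w ∘ suc) (valleyPoints 1 n) + 0))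
    ≡⟨ cong₂ _+_ (weigh-valleyPoints₀ n w) (cong₂ _+_ (weigh-valleyPoints₀ n (w ∘ suc))
                                                      (cong (_+ 0) (weigh-valleyPoints₁ n (w ∘ suc)))) ⟩
  Δ n w + (Δ n (w ∘ suc) + (Δ₋₁ n (w ∘ suc) + 0))
    ≡⟨ rearrange (Δ n w) (Δ n (w ∘ suc)) (Δ₋₁ n (w ∘ suc)) ⟩
  Δ n w + Δ n (w ∘ suc) + Δ₋₁ n (w ∘ suc)
    ≡⟨ delannoyPairing-suc n w ⟨
  Δ (suc n) w ∎
  where
  open ≡-Reasoning
  Δ = delannoyPairing
  Δ₋₁ = delannoyPairing₋₁
  rearrange : ∀ a b c → a + (b + (c + 0)) ≡ a + b + c
  rearrange = solve-∀
weigh-peakPoints₁ zero    w = refl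
weigh-peakPoints₁ (suc n) w = begin
  weigh w (peakPoints 1 (suc n))
    ≡⟨ weigh-choices w 4 (λ b → valleyPoints (b ∸ 2) n) ⟩
  weigh w (valleyPoints 0 n) + (weigh (w ∘ suc) (valleyPoints 0 n) +
    (weigh (w ∘ suc) (valleyPoints 0 n) + (weigh (w ∘ suc) (valleyPoints 1 n) + 0)))
    ≡⟨ cong₂ _+_ (weigh-valleyPoints₀ n w) (cong₂ _+_ (weigh-valleyPoints₀ n (w ∘ suc))
         (cong₂ _+_ (weigh-valleyPoints₀ n (w ∘ suc)) (cong (_+ 0) (weigh-valleyPoints₁ n (w ∘ suc))))) ⟩
  Δ n w + (Δ n (w ∘ suc) + (Δ n (w ∘ suc) + (Δ₋₁ n (w ∘ suc) + 0)))
    ≡⟨ rearrange (Δ n w) (Δ n (w ∘ suc)) (Δ₋₁ n (w ∘ suc)) ⟩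
  Δ n w + Δ n (w ∘ suc) + Δ₋₁ n (w ∘ suc) + Δ n (w ∘ suc)
    ≡⟨ cong (_+ Δ n (w ∘ suc)) (delannoyPairing-suc n w) ⟨
  Δ (suc n) w + Δ₋₁ (suc n) (w ∘ suc) ∎
  where
  open ≡-Reasoning
  Δ = delannoyPairing
  Δ₋₁ = delannoyPairing₋₁
  rearrange : ∀ a b c → a + (b + (b + (c + 0))) ≡ a + b + c + b
  rearrange = solve-∀

module _ {A : Set} {P : A → Set} {L : List A}
         (L-unique : Unique L) (L-enumerates : ∀ x → x ∈ L ⇔ P x) where

  HasCard-length : HasCard P (length L)
  HasCard-length = L , L-unique , L-enumerates , refl

  HasCard-filter : ∀ {Q : A → Set} (Q? : Decidable Q) → HasCard (λ x → P x × Q x) (length (filter Q? L))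
  HasCard-filter {Q} Q? = _ , Unique.filter⁺ Q? L-unique , filter-enumerates , refl
    where
    filter-enumerates : ∀ x → x ∈ filter Q? L ⇔ (P x × Q x)
    filter-enumerates x = mk⇔
      (λ x∈ → let x∈L , Qx = ∈-filter⁻ Q? x∈ in Equivalence.to (L-enumerates x) x∈L , Qx)
      (λ (Px , Qx) → ∈-filter⁺ Q? (Equivalence.from (L-enumerates x) Px) Qx)

proposition9p1 : (n : ℕ) → 1 ≤ n →
    ((i : ℕ) → HasCard (λ (x : Vec ℕ n) → InQZ n x × nonzeros x ≡ i) (delannoyCoeff n i))
    × HasCard (λ (x : Vec ℕ n) → InQZ n x) (delannoyEval n 1)
proposition9p1 n _ = coefficients , cardinality
  where
  open ≡-Reasoning
  points = valleyPoints 0 n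
  coefficients : (i : ℕ) → HasCard (λ x → InQZ n x × nonzeros x ≡ i) (delannoyCoeff n i)
  coefficients i = subst (HasCard (λ x → InQZ n x × nonzeros x ≡ i)) (begin
    length (filter (λ v → nonzeros v ≟ i) points)  ≡⟨ weigh-indicator i points ⟨
    weigh (indicator i) points                      ≡⟨ weigh-valleyPoints₀ n (indicator i) ⟩
    delannoyPairing n (indicator i)                 ≡⟨ delannoyPairing-indicator n i ⟩
    delannoyCoeff n i                               ∎)
    (HasCard-filter (valleyPoints-unique 0 n) (∈valleyPoints⇔InQZ n) (λ v → nonzeros v ≟ i))
  cardinality : HasCard (InQZ n) (delannoyEval n 1)
  cardinality = subst (HasCard (InQZ n)) (begin
    length points                ≡⟨ weigh-one points ⟨
    weigh (λ _ → 1) points       ≡⟨ weigh-valleyPoints₀ n (λ _ → 1) ⟩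
    delannoyPairing n (λ _ → 1)  ≡⟨ delannoyPairing-1 n ⟩
    delannoyEval n 1             ∎)
    (HasCard-length (valleyPoints-unique 0 n) (∈valleyPoints⇔InQZ n))
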